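{- Let $q,n,k$ be integers with $q\ge 4$, $n>k\ge 1$, or $q=3$, $n>k\ge 2$, or $q=2$, $n>k\ge 3$. Then \[\frac{\genfrac{[}{]}{0pt}{0}{n}{k}_q^2}{\binom{q^n}{q^k}}<\frac{1}{q^{(n-k)(q^k-2k)+k}}.\]
   Context: $\genfrac{[}{]}{0pt}{0}{n}{k}_q=\prod_{i=0}^{k-1}\frac{q^{n-i}-1}{q^{k-i}-1}$ is the Gaussian binomial coefficient and $\binom{a}{b}$ the ordinary binomial coefficient. -}

module Defs where

open import Data.Nat using (ℕ; zero; suc; _+_; _*_; _∸_; _^_)

-- Gaussian binomial [n k]_q = ∏_{i=0}^{k-1} (q^(n-i) - 1) / (q^(k-i) - 1)
-- written as a fraction gaussNum q n k / gaussDen q n k of the two products.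

prod : ℕ → (ℕ → ℕ) → ℕ
prod zero    f = 1
prod (suc m) f = prod m f * f m

gaussNum : ℕ → ℕ → ℕ → ℕ
gaussNum q n k = prod k (λ i → q ^ (n ∸ i) ∸ 1)

gaussDen : ℕ → ℕ → ℕ → ℕ
gaussDen q n k = prod k (λ i → q ^ (k ∸ i) ∸ 1)

-- exponent (n-k)(q^k - 2k) + k   (q^k ≥ 2k for q ≥ 2, so truncated ∸ is exact)
expo : ℕ → ℕ → ℕ → ℕ
expo q n k = (n ∸ k) * (q ^ k ∸ 2 * k) + k

-- Write K = q ^ k and N = q ^ n. Multiplying by K ! turns N C K into the falling factorial
-- (N)_K = N P′ K, and the inequality is proved by induction on n > k. Passing from n to n + 1 multiplies
-- the Gaussian binomial by (qN − 1)/(q^(n+1−k) − 1) and the power of q by q^(K − 2k), so after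
-- clearing denominators the step is (qN − 1)² q^K (N)_K ≤ (qN − K)² (qN)_K. As q (N − i) ≤ qN − i
-- factor by factor, all but the top three factors of the falling factorials can be dropped,
-- leaving a polynomial inequality. The base case n = k + 1 reduces in the same way, through the
-- top four factors, to 24 q⁴ (qK − 1)² < (q − 1)² K ((q − 1)K + 1)⋯((q − 1)K + 4); this is where
-- the hypotheses on q and k are needed (it is nearly tight at q = 4, k = 1). Each polynomial
-- inequality is proved by shifting the variables to their lower bounds and exhibiting the
-- difference of the two sides as a polynomial with nonnegative coefficients.

module Submission where

open import Defs
open import Data.Nat using (ℕ; _+_; _*_; _^_; _≤_; _<_)
open import Data.Nat.Combinatorics using (_C_)
open import Data.Sum using (_⊎_)
open import Data.Product using (_×_)
open import Relation.Binary.PropositionalEquality using (_≡_)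

open import Algebra.Definitions.RawMagma using (_,_)
open import Data.Nat
open import Data.Nat.Properties
open import Data.Nat.Combinatorics using (nCk≡nPk/k!)
open import Data.Nat.Combinatorics.Base using (_P′_; _P_)
open import Data.Nat.Combinatorics.Specification using (k!∣nP′k; nP′n≡n!; nPk≡n!/[n∸k]!; nP′k≡n!/[n∸k]!)
open import Data.Nat.DivMod using (m/n*n≡m)
open import Data.Nat.Tactic.RingSolver using (solve-∀)
open import Data.Product using (_,_)
open import Data.Sum using (inj₁; inj₂)
open import Relation.Binary.PropositionalEquality

-- Gaussian binomial coefficients and the exponent

prod-suc : ∀ m f → prod (suc m) f ≡ f 0 * prod m (λ i → f (suc i))
prod-suc zero    f = *-comm 1 (f 0)
prod-suc (suc m) f = trans (cong (_* f (suc m)) (prod-suc m f)) (*-assoc (f 0) _ _)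

prod-pos : ∀ m f → (∀ {i} → i < m → 0 < f i) → 0 < prod m f
prod-pos zero    f pos = z<s
prod-pos (suc m) f pos = *-mono-< (prod-pos m f (λ i<m → pos (m<n⇒m<1+n i<m))) (pos ≤-refl)

-- Both sides are the product of the first k + 1 factors of gaussNum q (suc n).
gaussNum-suc : ∀ q n k → gaussNum q (suc n) k * (q ^ (suc n ∸ k) ∸ 1) ≡ (q ^ suc n ∸ 1) * gaussNum q n k
gaussNum-suc q n k = prod-suc k (λ i → q ^ (suc n ∸ i) ∸ 1)

gaussDen-pos : ∀ {q} n k → 1 < q → 0 < gaussDen q n k
gaussDen-pos {q} n k 1<q =
  prod-pos k _ (λ i<k → m<n⇒0<n∸m (^-monoʳ-< q 1<q (m<n⇒0<n∸m i<k)))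

^*[^∸1]≡^∸^ : ∀ q {k m} → k ≤ m → q ^ k * (q ^ (m ∸ k) ∸ 1) ≡ q ^ m ∸ q ^ k
^*[^∸1]≡^∸^ q {k} {m} k≤m = begin
  q ^ k * (q ^ (m ∸ k) ∸ 1)        ≡⟨ *-distribˡ-∸ (q ^ k) (q ^ (m ∸ k)) 1 ⟩
  q ^ k * q ^ (m ∸ k) ∸ q ^ k * 1  ≡⟨ cong₂ _∸_ (sym (^-distribˡ-+-* q k (m ∸ k))) (*-identityʳ (q ^ k)) ⟩
  q ^ (k + (m ∸ k)) ∸ q ^ k        ≡⟨ cong (λ e → q ^ e ∸ q ^ k) (m+[n∸m]≡n k≤m) ⟩
  q ^ m ∸ q ^ k                    ∎
  where open ≡-Reasoning

2*n≤2^n : ∀ n → 2 * n ≤ 2 ^ n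
2*n≤2^n zero          = z≤n
2*n≤2^n (suc zero)    = ≤-refl
2*n≤2^n (suc (suc n)) = begin
  2 * suc (suc n)        ≡⟨ *-suc 2 (suc n) ⟩
  2 + 2 * suc n          ≤⟨ +-mono-≤ (^-monoʳ-≤ 2 (s≤s (z≤n {n}))) (2*n≤2^n (suc n)) ⟩
  2 ^ suc n + 2 ^ suc n  ≡⟨ cong (2 ^ suc n +_) (sym (+-identityʳ _)) ⟩
  2 ^ suc (suc n)        ∎
  where open ≤-Reasoning

expo-base : ∀ q k → 2 * k ≤ q ^ k → expo q (suc k) k + k ≡ q ^ k
expo-base q k 2k≤K = begin
  (suc k ∸ k) * r + k + k  ≡⟨ cong (λ d → d * r + k + k) (m+n∸n≡m 1 k) ⟩
  1 * r + k + k            ≡⟨ regroup r k ⟩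
  2 * k + r                ≡⟨ m+[n∸m]≡n 2k≤K ⟩
  q ^ k                    ∎
  where
  open ≡-Reasoning
  r = q ^ k ∸ 2 * k
  regroup : ∀ r k → 1 * r + k + k ≡ 2 * k + r
  regroup = solve-∀

expo-suc : ∀ q {n k} → k ≤ n → 2 * k ≤ q ^ k → expo q (suc n) k + k + k ≡ expo q n k + q ^ k
expo-suc q {n} {k} k≤n 2k≤K = begin
  (suc n ∸ k) * r + k + k + k    ≡⟨ cong (λ d → d * r + k + k + k) (+-∸-assoc 1 k≤n) ⟩
  suc (n ∸ k) * r + k + k + k    ≡⟨ regroup (n ∸ k) r k ⟩
  (n ∸ k) * r + k + (2 * k + r)  ≡⟨ cong (expo q n k +_) (m+[n∸m]≡n 2k≤K) ⟩
  expo q n k + q ^ k             ∎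
  where
  open ≡-Reasoning
  r = q ^ k ∸ 2 * k
  regroup : ∀ d r k → suc d * r + k + k + k ≡ d * r + k + (2 * k + r)
  regroup = solve-∀

-- Falling factorials

[m+n]+o∸n≡m+o : ∀ m n o → m + n + o ∸ n ≡ m + o
[m+n]+o∸n≡m+o m n o =
  trans (cong (_∸ n) (trans (cong (_+ o) (+-comm m n)) (+-assoc n m o))) (m+n∸m≡n n (m + o))

P′-+ : ∀ n j t → n P′ (t + j) ≡ ((n ∸ j) P′ t) * (n P′ j)
P′-+ n j zero    = sym (*-identityˡ (n P′ j))
P′-+ n j (suc t) = begin
  (n ∸ (t + j)) * (n P′ (t + j))              ≡⟨ cong₂ _*_ n∸[t+j]≡n∸j∸t (P′-+ n j t) ⟩
  (n ∸ j ∸ t) * (((n ∸ j) P′ t) * (n P′ j))  ≡⟨ sym (*-assoc (n ∸ j ∸ t) _ _) ⟩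
  ((n ∸ j) P′ suc t) * (n P′ j)              ∎
  where
  open ≡-Reasoning
  n∸[t+j]≡n∸j∸t = trans (cong (n ∸_) (+-comm t j)) (sym (∸-+-assoc n j t))

P′-pos : ∀ {n} j → j ≤ n → 0 < n P′ j
P′-pos zero    _   = z<s
P′-pos (suc j) j<n = *-mono-< (m<n⇒0<n∸m j<n) (P′-pos j (<⇒≤ j<n))

*-∸-≤ : ∀ c n j → c * (n ∸ j) ≤ c * n ∸ j
*-∸-≤ zero        n j = z≤n
*-∸-≤ c@(suc _)   n j = ≤-trans (≤-reflexive (*-distribˡ-∸ c n j)) (∸-monoʳ-≤ (c * n) (m≤n*m j c))

^*P′≤*P′ : ∀ c n j → c ^ j * (n P′ j) ≤ (c * n) P′ j
^*P′≤*P′ c n zero    = ≤-refl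
^*P′≤*P′ c n (suc j) = begin
  c * c ^ j * ((n ∸ j) * (n P′ j))  ≡⟨ [m*n]*[o*p]≡[m*o]*[n*p] c (c ^ j) (n ∸ j) (n P′ j) ⟩
  c * (n ∸ j) * (c ^ j * (n P′ j))  ≤⟨ *-mono-≤ (*-∸-≤ c n j) (^*P′≤*P′ c n j) ⟩
  (c * n ∸ j) * ((c * n) P′ j)      ∎
  where open ≤-Reasoning

*-^*P′-+ : ∀ A c n j t →
           A * (c ^ (t + j) * (n P′ (t + j))) ≡ A * (c ^ t * ((n ∸ j) P′ t)) * (c ^ j * (n P′ j))
*-^*P′-+ A c n j t = begin
  A * (c ^ (t + j) * (n P′ (t + j)))                 ≡⟨ cong (A *_) (cong₂ _*_ (^-distribˡ-+-* c t j) (P′-+ n j t)) ⟩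
  A * (c ^ t * c ^ j * (((n ∸ j) P′ t) * (n P′ j)))  ≡⟨ cong (A *_) ([m*n]*[o*p]≡[m*o]*[n*p] (c ^ t) (c ^ j) _ _) ⟩
  A * (c ^ t * ((n ∸ j) P′ t) * (c ^ j * (n P′ j)))  ≡⟨ sym (*-assoc A _ _) ⟩
  A * (c ^ t * ((n ∸ j) P′ t)) * (c ^ j * (n P′ j))  ∎
  where open ≡-Reasoning

*-P′-+ : ∀ B n j t → B * ((n ∸ j) P′ t) * (n P′ j) ≡ B * (n P′ (t + j))
*-P′-+ B n j t = trans (*-assoc B _ _) (cong (B *_) (sym (P′-+ n j t)))

top-factors-≤ : ∀ c n j t {A B} → A * (c ^ t * ((n ∸ j) P′ t)) ≤ B * ((c * n ∸ j) P′ t) →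
                A * (c ^ (t + j) * (n P′ (t + j))) ≤ B * ((c * n) P′ (t + j))
top-factors-≤ c n j t {A} {B} top = begin
  A * (c ^ (t + j) * (n P′ (t + j)))                 ≡⟨ *-^*P′-+ A c n j t ⟩
  A * (c ^ t * ((n ∸ j) P′ t)) * (c ^ j * (n P′ j))  ≤⟨ *-mono-≤ top (^*P′≤*P′ c n j) ⟩
  B * ((c * n ∸ j) P′ t) * ((c * n) P′ j)            ≡⟨ *-P′-+ B (c * n) j t ⟩
  B * ((c * n) P′ (t + j))                           ∎
  where open ≤-Reasoning

top-factors-< : ∀ c n j t {A B} .{{_ : NonZero c}} → j ≤ n →
                A * (c ^ t * ((n ∸ j) P′ t)) < B * ((c * n ∸ j) P′ t) →
                A * (c ^ (t + j) * (n P′ (t + j))) < B * ((c * n) P′ (t + j))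
top-factors-< c n j t {A} {B} j≤n top = begin-strict
  A * (c ^ (t + j) * (n P′ (t + j)))                 ≡⟨ *-^*P′-+ A c n j t ⟩
  A * (c ^ t * ((n ∸ j) P′ t)) * (c ^ j * (n P′ j))  <⟨ *-monoˡ-< _ {{lower≢0}} top ⟩
  B * ((c * n ∸ j) P′ t) * (c ^ j * (n P′ j))        ≤⟨ *-monoʳ-≤ (B * ((c * n ∸ j) P′ t)) (^*P′≤*P′ c n j) ⟩
  B * ((c * n ∸ j) P′ t) * ((c * n) P′ j)            ≡⟨ *-P′-+ B (c * n) j t ⟩
  B * ((c * n) P′ (t + j))                           ∎
  where
  open ≤-Reasoning
  lower≢0 = >-nonZero (*-mono-< (m^n>0 c j) (P′-pos j j≤n))

C*!≡P′ : ∀ {n k} → k ≤ n → (n C k) * k ! ≡ n P′ k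
C*!≡P′ {n} {k} k≤n = begin
  (n C k) * k !           ≡⟨ cong (_* k !) (nCk≡nPk/k! k≤n) ⟩
  ((n P k) / k !) * k !   ≡⟨ cong (λ p → (p / k !) * k !) P≡P′ ⟩
  ((n P′ k) / k !) * k !  ≡⟨ m/n*n≡m (k!∣nP′k k≤n) ⟩
  n P′ k                  ∎
  where
  open ≡-Reasoning
  instance _ = k !≢0
  P≡P′ = trans (nPk≡n!/[n∸k]! k≤n) (sym (nP′k≡n!/[n∸k]! k≤n))

<-C-from-P′ : ∀ {A N K D} → K ≤ N → A * K ! < (N P′ K) * D → A < (N C K) * D
<-C-from-P′ {A} {N} {K} {D} K≤N bound =
  *-cancelʳ-< (K !) A ((N C K) * D) (subst (A * K ! <_) P′≡C*! bound)
  where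
  regroup : ∀ c f d → c * f * d ≡ c * d * f
  regroup = solve-∀
  P′≡C*! = trans (cong (_* D) (sym (C*!≡P′ K≤N))) (regroup (N C K) (K !) D)

-- Polynomial inequalities

-- q * N ∸ K for q = 1 + a and N = K + m
excess : ℕ → ℕ → ℕ → ℕ
excess a K m = a * K + suc a * m

suc*[K+m]≡K+excess : ∀ a K m → suc a * (K + m) ≡ K + excess a K m
suc*[K+m]≡K+excess = identity
  where
  identity : ∀ a K m → suc a * (K + m) ≡ K + (a * K + suc a * m)
  identity = solve-∀

top-factor₁ : ∀ a K m → 1 ≤ a → 2 ≤ K →
              suc a * suc m * (K ∸ 1 + excess a K m) ≤ excess a K m * suc (excess a K m)
top-factor₁ (suc b) (suc (suc c)) m (s≤s z≤n) (s≤s (s≤s z≤n)) = ≤″⇒≤ (_ , certificate b c m)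
  where
  certificate : ∀ b c m → let Z = suc b * (2 + c) + (2 + b) * m in
    (2 + b) * suc m * (suc c + Z) + (Z * b * suc c + suc c * (suc b * c + b)) ≡ Z * suc Z
  certificate = solve-∀

top-factor₂ : ∀ a K m → 2 ≤ a → 3 ≤ K →
              suc a * (2 + m) * (K ∸ 1 + excess a K m) ≤ excess a K m * (2 + excess a K m)
top-factor₂ (suc (suc b)) (suc (suc (suc c))) m (s≤s (s≤s z≤n)) (s≤s (s≤s (s≤s z≤n))) =
  ≤″⇒≤ (_ , certificate b c m)
  where
  certificate : ∀ b c m → let Z = (2 + b) * (3 + c) + (3 + b) * m in
    (3 + b) * (2 + m) * (2 + c + Z) + (Z * (b + c + b * c) + (2 + c) * (b + 2 * c + b * c))
      ≡ Z * (2 + Z)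
  certificate = solve-∀

top-factor₃ : ∀ a K m → 3 ≤ K → suc a * (3 + m) ≤ 3 + excess a K m
top-factor₃ a (suc (suc (suc c))) m (s≤s (s≤s (s≤s z≤n))) = ≤″⇒≤ (_ , certificate a c m)
  where
  certificate : ∀ a c m → suc a * (3 + m) + a * c ≡ 3 + (a * (3 + c) + suc a * m)
  certificate = solve-∀

top-factors₂₃ : ∀ a K m → 1 ≤ a → 4 ≤ K →
                suc a * (2 + m) * (K ∸ 1 + excess a K m) * (suc a * (3 + m))
                  ≤ excess a K m * (2 + excess a K m) * (3 + excess a K m)
top-factors₂₃ (suc zero) (suc (suc (suc (suc c)))) m _ (s≤s (s≤s (s≤s (s≤s z≤n)))) =
  ≤″⇒≤ (_ , certificate c m)
  where
  certificate : ∀ c m → let Z = 1 * (4 + c) + 2 * m in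
    2 * (2 + m) * (3 + c + Z) * (2 * (3 + m))
      + c * ((4 + 2 * m) * (4 + 2 * c + 2 * m) + 6 * Z + c * (3 + c + 2 * m) + 6)
      ≡ Z * (2 + Z) * (3 + Z)
  certificate = solve-∀
top-factors₂₃ a@(suc (suc _)) K m _ 4≤K =
  *-mono-≤ (top-factor₂ a K m (s≤s (s≤s z≤n)) 3≤K) (top-factor₃ a K m 3≤K)
  where 3≤K = ≤-trans (n≤1+n 3) 4≤K

step-top-factors : ∀ a K m → 1 ≤ a → 4 ≤ K →
            (K ∸ 1 + excess a K m) * (K ∸ 1 + excess a K m) * (suc a ^ 3 * ((3 + m) P′ 3))
              ≤ excess a K m * excess a K m * ((3 + excess a K m) P′ 3)
step-top-factors a K m 1≤a 4≤K = begin
  W * W * (q ^ 3 * ((3 + m) P′ 3))                   ≡⟨ regroup q W (1 + m) (2 + m) (3 + m) ⟩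
  q * (1 + m) * W * (q * (2 + m) * W * (q * (3 + m)))
    ≤⟨ *-mono-≤ (top-factor₁ a K m 1≤a 2≤K) (top-factors₂₃ a K m 1≤a 4≤K) ⟩
  Z * (1 + Z) * (Z * (2 + Z) * (3 + Z))              ≡⟨ regroup′ Z ⟩
  Z * Z * ((3 + Z) P′ 3)                              ∎
  where
  open ≤-Reasoning
  q = suc a
  Z = excess a K m
  W = K ∸ 1 + Z
  2≤K = ≤-trans (n≤1+n 2) (≤-trans (n≤1+n 3) 4≤K)
  regroup : ∀ q W m₁ m₂ m₃ → W * W * (q * (q * (q * 1)) * (m₁ * (m₂ * (m₃ * 1))))
                             ≡ q * m₁ * W * (q * m₂ * W * (q * m₃))
  regroup = solve-∀
  regroup′ : ∀ Z → Z * (1 + Z) * (Z * (2 + Z) * (3 + Z)) ≡ Z * Z * ((1 + Z) * ((2 + Z) * ((3 + Z) * 1)))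
  regroup′ = solve-∀

-- The hypotheses of the theorem, for K = q ^ k.
data Admissible : ℕ → ℕ → Set where
  q≥4 : ∀ {a K} → 3 ≤ a → 4 ≤ K → Admissible (suc a) K
  q≡3 : ∀ {K} → 9 ≤ K → Admissible 3 K
  q≡2 : ∀ {K} → 8 ≤ K → Admissible 2 K

admissible⇒1≤a : ∀ {a K} → Admissible (suc a) K → 1 ≤ a
admissible⇒1≤a (q≥4 3≤a _) = ≤-trans (s≤s z≤n) 3≤a
admissible⇒1≤a (q≡3 _)     = s≤s z≤n
admissible⇒1≤a (q≡2 _)     = s≤s z≤n

admissible⇒4≤K : ∀ {q K} → Admissible q K → 4 ≤ K
admissible⇒4≤K (q≥4 _ 4≤K) = 4≤K
admissible⇒4≤K (q≡3 9≤K)   = ≤-trans (m≤m+n 4 5) 9≤K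
admissible⇒4≤K (q≡2 8≤K)   = ≤-trans (m≤m+n 4 4) 8≤K

base-top-factors : ∀ {a K} → Admissible (suc a) K →
            24 * suc a ^ 4 * ((suc a * K ∸ 1) * (suc a * K ∸ 1)) < a * a * K * ((4 + a * K) P′ 4)
base-top-factors (q≥4 3≤a 4≤K) with x , refl ← m≤n⇒∃[o]m+o≡n 3≤a | y , refl ← m≤n⇒∃[o]m+o≡n 4≤K =
  ≤″⇒≤ (_ , certificate x y)
  where
  certificate : ∀ x y → let q = 4 + x; a = 3 + x; K = 4 + y; X = a * K; M = 3 + y + X in
    suc (24 * (q * (q * (q * (q * 1)))) * (M * M))
      + (x * (x * (x * (x * (x * (x
          * (y * (y * (y * (y * (y + 20) + 160) + 616) + 1088) + 640)
          + (y * (y * (y * (y * (y * 18 + 370) + 3040) + 11904) + 21040) + 11968))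
          + (y * (y * (y * (y * (y * 135 + 2850) + 24035) + 95460) + 167760) + 90536))
          + (y * (y * (y * (y * (y * 540 + 11700) + 101220) + 406370) + 704080) + 349856))
          + (y * (y * (y * (y * (y * 1215 + 27000) + 239490) + 967770) + 1634184) + 709632))
          + (y * (y * (y * (y * (y * 1458 + 33210) + 301860) + 1221174) + 1977216) + 674208))
          + (y * (y * (y * (y * (y * 729 + 17010) + 158355) + 636906) + 965016) + 190079))
      ≡ a * a * K * ((1 + X) * ((2 + X) * ((3 + X) * ((4 + X) * 1))))
  certificate = solve-∀
base-top-factors (q≡3 9≤K) with y , refl ← m≤n⇒∃[o]m+o≡n 9≤K = ≤″⇒≤ (_ , certificate y)
  where
  certificate : ∀ y → let K = 9 + y; X = 2 * K; M = 8 + y + X in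
    suc (24 * (3 * (3 * (3 * (3 * 1)))) * (M * M))
      + (y * (y * (y * (y * (y * 64 + 3200) + 63920) + 620104) + 2872752) + 5006015)
      ≡ 2 * 2 * K * ((1 + X) * ((2 + X) * ((3 + X) * ((4 + X) * 1))))
  certificate = solve-∀
base-top-factors (q≡2 8≤K) with y , refl ← m≤n⇒∃[o]m+o≡n 8≤K = ≤″⇒≤ (_ , certificate y)
  where
  certificate : ∀ y → let K = 8 + y; X = 1 * K; M = 7 + y + X in
    suc (24 * (2 * (2 * (2 * (2 * 1)))) * (M * M))
      + (y * (y * (y * (y * (y + 50) + 995) + 8314) + 25464) + 8639)
      ≡ 1 * 1 * K * ((1 + X) * ((2 + X) * ((3 + X) * ((4 + X) * 1))))
  certificate = solve-∀

base-ineq : ∀ {a K} → Admissible (suc a) K →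
            (suc a * K ∸ 1) * (suc a * K ∸ 1) * (suc a ^ K * (K P′ K)) < a * a * K * ((suc a * K) P′ K)
base-ineq {a} adm with c , refl ← m≤n⇒∃[o]m+o≡n (admissible⇒4≤K adm) =
  top-factors-< q K c 4 {A = M * M} {B = a * a * K} (m≤n+m c 4) top-four
  where
  open ≤-Reasoning
  q = suc a
  K = 4 + c
  M = q * K ∸ 1
  reorder : ∀ M Q → M * M * (Q * 24) ≡ 24 * Q * (M * M)
  reorder = solve-∀
  top-four : M * M * (q ^ 4 * ((K ∸ c) P′ 4)) < a * a * K * ((q * K ∸ c) P′ 4)
  top-four = begin-strict
    M * M * (q ^ 4 * ((K ∸ c) P′ 4))  ≡⟨ cong (λ u → M * M * (q ^ 4 * (u P′ 4))) (m+n∸n≡m 4 c) ⟩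
    M * M * (q ^ 4 * 24)              ≡⟨ reorder M (q ^ 4) ⟩
    24 * q ^ 4 * (M * M)              <⟨ base-top-factors adm ⟩
    a * a * K * ((4 + a * K) P′ 4)    ≡⟨ cong (λ v → a * a * K * (v P′ 4)) (sym ([m+n]+o∸n≡m+o 4 c (a * K))) ⟩
    a * a * K * ((q * K ∸ c) P′ 4)    ∎

step-ineq : ∀ a {K N} → 1 ≤ a → 4 ≤ K → K ≤ N →
            (suc a * N ∸ 1) * (suc a * N ∸ 1) * (suc a ^ K * (N P′ K))
              ≤ (suc a * N ∸ K) * (suc a * N ∸ K) * ((suc a * N) P′ K)
step-ineq a 1≤a 4≤K K≤N with j , refl ← m≤n⇒∃[o]m+o≡n (≤-trans (n≤1+n 3) 4≤K)
                            | m , refl ← m≤n⇒∃[o]m+o≡n K≤N =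
  top-factors-≤ q N j 3 {A = (q * N ∸ 1) * (q * N ∸ 1)} {B = (q * N ∸ K) * (q * N ∸ K)} top-three
  where
  open ≤-Reasoning
  q = suc a
  K = 3 + j
  N = K + m
  Z = excess a K m
  qN≡K+Z : q * N ≡ K + Z
  qN≡K+Z = suc*[K+m]≡K+excess a K m
  top-three : (q * N ∸ 1) * (q * N ∸ 1) * (q ^ 3 * ((N ∸ j) P′ 3))
                ≤ (q * N ∸ K) * (q * N ∸ K) * ((q * N ∸ j) P′ 3)
  top-three = begin
    (q * N ∸ 1) * (q * N ∸ 1) * (q ^ 3 * ((N ∸ j) P′ 3))
      ≡⟨ cong₂ (λ u v → u * u * (q ^ 3 * (v P′ 3))) (cong (_∸ 1) qN≡K+Z) ([m+n]+o∸n≡m+o 3 j m) ⟩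
    (K ∸ 1 + Z) * (K ∸ 1 + Z) * (q ^ 3 * ((3 + m) P′ 3))
      ≤⟨ step-top-factors a K m 1≤a 4≤K ⟩
    Z * Z * ((3 + Z) P′ 3)
      ≡⟨ cong₂ (λ u v → u * u * (v P′ 3)) (sym qN∸K≡Z) (sym qN∸j≡3+Z) ⟩
    (q * N ∸ K) * (q * N ∸ K) * ((q * N ∸ j) P′ 3) ∎
    where
    qN∸K≡Z = trans (cong (_∸ K) qN≡K+Z) (m+n∸m≡n K Z)
    qN∸j≡3+Z = trans (cong (_∸ j) qN≡K+Z) ([m+n]+o∸n≡m+o 3 j Z)

-- Induction on n

FallingBound : ℕ → ℕ → ℕ → Set
FallingBound q n k = gaussNum q n k * gaussNum q n k * q ^ expo q n k * (q ^ k) !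
                       < ((q ^ n) P′ (q ^ k)) * (gaussDen q n k * gaussDen q n k)

module _ {a k : ℕ} (adm : Admissible (suc a) (suc a ^ k)) where
  private
    q = suc a
    K = q ^ k
    D = gaussDen q k k
    1≤a = admissible⇒1≤a adm
    4≤K = admissible⇒4≤K adm
    2k≤K = ≤-trans (2*n≤2^n k) (^-monoˡ-≤ k (s≤s 1≤a))
    instance
      D*D≢0 : NonZero (D * D)
      D*D≢0 = >-nonZero (*-mono-< D-pos D-pos)
        where D-pos = gaussDen-pos k k (s≤s 1≤a)

  falling-bound-base : FallingBound q (suc k) k
  falling-bound-base = *-cancelʳ-< (a * a * K) _ _ (begin-strict
    U * U * q ^ E * K ! * (a * a * K)        ≡⟨ regroup₁ U (q ^ E) (K !) a K ⟩
    U * a * (U * a) * (q ^ E * K) * K !      ≡⟨ cong₂ (λ u v → u * u * v * K !) U*a≡M*D q^E*K≡q^K ⟩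
    M * D * (M * D) * q ^ K * K !            ≡⟨ regroup₂ M D (q ^ K) (K !) ⟩
    D * D * (M * M * (q ^ K * K !))          ≡⟨ cong (λ f → D * D * (M * M * (q ^ K * f))) (sym (nP′n≡n! K)) ⟩
    D * D * (M * M * (q ^ K * (K P′ K)))     <⟨ *-monoʳ-< (D * D) (base-ineq adm) ⟩
    D * D * (a * a * K * ((q * K) P′ K))     ≡⟨ regroup₃ D (a * a * K) ((q * K) P′ K) ⟩
    ((q * K) P′ K) * (D * D) * (a * a * K)   ∎)
    where
    open ≤-Reasoning
    U = gaussNum q (suc k) k
    E = expo q (suc k) k
    M = q * K ∸ 1
    U*a≡M*D : U * a ≡ M * D
    U*a≡M*D = trans (cong (U *_) (sym G≡a)) (gaussNum-suc q k k)
      where G≡a = trans (cong (λ e → q ^ e ∸ 1) (m+n∸n≡m 1 k)) (*-identityʳ a)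
    q^E*K≡q^K : q ^ E * K ≡ q ^ K
    q^E*K≡q^K = trans (sym (^-distribˡ-+-* q E k)) (cong (q ^_) (expo-base q k 2k≤K))
    regroup₁ : ∀ U P F a K → U * U * P * F * (a * a * K) ≡ U * a * (U * a) * (P * K) * F
    regroup₁ = solve-∀
    regroup₂ : ∀ M D P F → M * D * (M * D) * P * F ≡ D * D * (M * M * (P * F))
    regroup₂ = solve-∀
    regroup₃ : ∀ D B R → D * D * (B * R) ≡ R * (D * D) * B
    regroup₃ = solve-∀

  falling-bound-suc : ∀ {n} → k < n → FallingBound q n k → FallingBound q (suc n) k
  falling-bound-suc {n} k<n bound = *-cancelʳ-< (K * G * (K * G)) _ _ (begin-strict
    U′ * U′ * q ^ E′ * K ! * (K * G * (K * G))           ≡⟨ regroup₁ U′ (q ^ E′) (K !) K G ⟩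
    U′ * G * (U′ * G) * (q ^ E′ * K * K) * K !           ≡⟨ cong₂ (λ u v → u * u * v * K !) (gaussNum-suc q n k) q^E′*K*K≡q^E*q^K ⟩
    (X ∸ 1) * U * ((X ∸ 1) * U) * (q ^ E * q ^ K) * K !  ≡⟨ regroup₂ (X ∸ 1) U (q ^ E) (q ^ K) (K !) ⟩
    (X ∸ 1) * (X ∸ 1) * q ^ K * (U * U * q ^ E * K !)    <⟨ *-monoʳ-< _ {{Y≢0}} bound ⟩
    (X ∸ 1) * (X ∸ 1) * q ^ K * ((N P′ K) * (D * D))     ≡⟨ regroup₃ (X ∸ 1) (q ^ K) (N P′ K) (D * D) ⟩
    (X ∸ 1) * (X ∸ 1) * (q ^ K * (N P′ K)) * (D * D)     ≤⟨ *-monoˡ-≤ (D * D) (step-ineq a 1≤a 4≤K K≤N) ⟩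
    (X ∸ K) * (X ∸ K) * (X P′ K) * (D * D)               ≡⟨ cong (λ g → g * g * (X P′ K) * (D * D)) (sym K*G≡X∸K) ⟩
    K * G * (K * G) * (X P′ K) * (D * D)                 ≡⟨ regroup₄ (K * G) (X P′ K) (D * D) ⟩
    (X P′ K) * (D * D) * (K * G * (K * G))               ∎)
    where
    open ≤-Reasoning
    N = q ^ n
    X = q * N
    U = gaussNum q n k
    U′ = gaussNum q (suc n) k
    E = expo q n k
    E′ = expo q (suc n) k
    G = q ^ (suc n ∸ k) ∸ 1
    K≤N = ^-monoʳ-≤ q (<⇒≤ k<n)
    K*G≡X∸K = ^*[^∸1]≡^∸^ q (≤-trans (<⇒≤ k<n) (n≤1+n n))
    q^E′*K*K≡q^E*q^K : q ^ E′ * K * K ≡ q ^ E * q ^ K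
    q^E′*K*K≡q^E*q^K = begin-equality
      q ^ E′ * K * K   ≡⟨ cong (_* K) (sym (^-distribˡ-+-* q E′ k)) ⟩
      q ^ (E′ + k) * K ≡⟨ sym (^-distribˡ-+-* q (E′ + k) k) ⟩
      q ^ (E′ + k + k) ≡⟨ cong (q ^_) (expo-suc q (<⇒≤ k<n) 2k≤K) ⟩
      q ^ (E + K)      ≡⟨ ^-distribˡ-+-* q E K ⟩
      q ^ E * q ^ K    ∎
    X∸1>0 = m<n⇒0<n∸m (^-monoʳ-< q (s≤s 1≤a) (z<s {n}))
    Y≢0 = >-nonZero (*-mono-< (*-mono-< X∸1>0 X∸1>0) (m^n>0 q K))
    regroup₁ : ∀ U P F K G → U * U * P * F * (K * G * (K * G)) ≡ U * G * (U * G) * (P * K * K) * F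
    regroup₁ = solve-∀
    regroup₂ : ∀ Y U P Q F → Y * U * (Y * U) * (P * Q) * F ≡ Y * Y * Q * (U * U * P * F)
    regroup₂ = solve-∀
    regroup₃ : ∀ Y Q R S → Y * Y * Q * (R * S) ≡ Y * Y * (Q * R) * S
    regroup₃ = solve-∀
    regroup₄ : ∀ Z R S → Z * Z * R * S ≡ R * S * (Z * Z)
    regroup₄ = solve-∀

  falling-bound : ∀ {n} → k < n → FallingBound q n k
  falling-bound {suc n} (s≤s k≤n) with m≤n⇒m<n∨m≡n k≤n
  ... | inj₁ k<n  = falling-bound-suc k<n (falling-bound k<n)
  ... | inj₂ refl = falling-bound-base

gaussian-binomial-bound : ∀ {a n k} → Admissible (suc a) (suc a ^ k) → k < n →
  gaussNum (suc a) n k * gaussNum (suc a) n k * suc a ^ expo (suc a) n k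
    < ((suc a ^ n) C (suc a ^ k)) * (gaussDen (suc a) n k * gaussDen (suc a) n k)
gaussian-binomial-bound {a} adm k<n = <-C-from-P′ (^-monoʳ-≤ (suc a) (<⇒≤ k<n)) (falling-bound adm k<n)

corollary3p3 : (q n k : ℕ) →
    ((4 ≤ q × k < n × 1 ≤ k) ⊎ (q ≡ 3 × k < n × 2 ≤ k) ⊎ (q ≡ 2 × k < n × 3 ≤ k)) →
    gaussNum q n k * gaussNum q n k * q ^ expo q n k
    < ((q ^ n) C (q ^ k)) * (gaussDen q n k * gaussDen q n k)
corollary3p3 q n k (inj₁ (4≤q@(s≤s 3≤a) , k<n , 1≤k)) =
  gaussian-binomial-bound (q≥4 3≤a (≤-trans 4≤q q≤q^k)) k<n
  where q≤q^k = ≤-trans (≤-reflexive (sym (*-identityʳ q))) (^-monoʳ-≤ q 1≤k)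
corollary3p3 q n k (inj₂ (inj₁ (refl , k<n , 2≤k))) = gaussian-binomial-bound (q≡3 (^-monoʳ-≤ 3 2≤k)) k<n
corollary3p3 q n k (inj₂ (inj₂ (refl , k<n , 3≤k))) = gaussian-binomial-bound (q≡2 (^-monoʳ-≤ 2 3≤k)) k<n
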